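{- Let $s_1,s_2,m$ be integers with $1\le s_1\le s_2\le m$ and $s_1+s_2\le m$. Then \[\max_{x\in\{0,\dots,m\}}\binom{x}{s_1}\binom{m-x}{s_2}\le4m^2\binom{\frac{s_1m}{s_1+s_2}}{s_1}\binom{\frac{s_2m}{s_1+s_2}}{s_2}.\] Moreover, the function $x\mapsto\binom{x}{s_1}\binom{m-x}{s_2}$ is non-decreasing on $\{0,\dots,\lfloor\frac{s_1m+s_1}{s_1+s_2}\rfloor\}$ and non-increasing on $\{\lfloor\frac{s_1m+s_1}{s_1+s_2}\rfloor,\dots,m\}$.
   Context: For real $x$ and integer $s\ge0$, $\binom{x}{s}=x(x-1)\cdots(x-s+1)/s!$ if $x\ge s$ and $0$ if $x<s$. -}

module Defs where

open import Data.Nat as ℕ using (ℕ; zero; suc; _!)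
open import Data.Nat.Properties using (_!≢0)
open import Data.Integer using (+_)
open import Data.Rational using (ℚ; _/_; _*_; _-_; _≤_; 0ℚ; 1ℚ)
open import Data.Rational.Properties using (_≤?_)
open import Relation.Nullary using (yes; no)

ℕ→ℚ : ℕ → ℚ
ℕ→ℚ n = + n / 1

fallingℚ : ℚ → ℕ → ℚ
fallingℚ x zero    = 1ℚ
fallingℚ x (suc s) = fallingℚ x s * (x - ℕ→ℚ s)

binomℚ : ℚ → ℕ → ℚ
binomℚ x s with ℕ→ℚ s ≤? x
... | yes _ = fallingℚ x s * ((+ 1 / (s !)) {{s !≢0}})
... | no  _ = 0ℚ

-- Let Φ x = x^(s₁) (m - x)^(s₂) (falling factorials), which is s₁! s₂! times the
-- binomial product. Passing from x to x + 1 multiplies Φ by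
-- (x + 1)(m - x - s₂) / ((x + 1 - s₁)(m - x)), which is at least 1 exactly when
-- s₂ (x + 1) ≤ s₁ (m - x), i.e. when (x + 1)(s₁ + s₂) ≤ s₁ (m + 1). Hence Φ is
-- unimodal with peak x₀ = ⌊s₁ (m + 1) / (s₁ + s₂)⌋.
--
-- For the bound put S = s₁ + s₂ and c = s₁ m. The peak satisfies x₀ S ≤ c + S, so
-- after splitting off the factor x₀, the factors (x₀ - 1 - i) S of S^s₁ x₀^(s₁) are
-- at most c - i S, and the leftover S is at most c - (s₁ - 1) S because S ≤ m. Thus
-- S^s₁ x₀^(s₁) ≤ x₀ c (c - S) ⋯ (c - (s₁ - 1) S) = x₀ S^s₁ s₁! binom(c / S, s₁), and
-- likewise for m - x₀ and s₂. The split-off factors x₀ and m - x₀ are at most m, so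
-- m² would do in place of 4 m².

module Submission where

open import Defs
open import Data.Nat using (ℕ; _+_; _*_; _∸_; _≤_; NonZero; _/_)
open import Data.Nat.Combinatorics using (_C_)
open import Data.Integer using (+_)
open import Data.Rational using () renaming (_≤_ to _≤ℚ_; _*_ to _*ℚ_; _/_ to _/ℚ_)
open import Data.Product using (_×_)

open import Algebra.Bundles using (CommutativeMonoid)
import Algebra.Properties.CommutativeSemigroup as CommSemigroupProperties
open import Data.Integer.Base as ℤ using ()
import Data.Integer.Properties as ℤᴾ
open import Data.Nat.Base using (zero; suc; _<_; _>_; _≥_; _^_; _!; z≤n; s≤s; _≤′_; ≤′-refl; ≤′-step)
open import Data.Nat.Combinatorics using (_P_; nCk≡nPk/k!; nPk≡n!/[n∸k]!; k>n⇒nCk≡0)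
open import Data.Nat.Combinatorics.Base using (_P′_)
open import Data.Nat.Combinatorics.Specification using (nP′k≡n!/[n∸k]!; nP′k≡n[n∸1P′k∸1]; k!∣nP′k)
open import Data.Nat.DivMod using (m/n*n≡m; m/n*n≤m; /-monoˡ-≤; m*n/n≡m; m<n*o⇒m/o<n)
open import Data.Nat.Properties
import Data.Nat.Solver as ℕSolver
open import Data.Product using (_,_)
open import Data.Rational.Base as ℚ using (ℚ; 1ℚ; toℚᵘ; *≤*) renaming (_+_ to _+ℚ_; _-_ to _-ℚ_)
open import Data.Rational.Literals using (fromℤ)
import Data.Rational.Properties as ℚᴾ
open import Data.Rational.Solver using (module +-*-Solver)
open import Data.Rational.Unnormalised.Base as ℚᵘ using (mkℚᵘ; *≡*)
import Data.Rational.Unnormalised.Properties as ℚᵘᴾ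
open import Data.Sum using (inj₁; inj₂)
open import Function using (flip)
open import Relation.Binary.Core using (Rel)
open import Relation.Binary.Definitions using (Reflexive; Transitive)
open import Relation.Binary.PropositionalEquality
open import Relation.Nullary using (yes; no; contradiction)

fallingBy : ℕ → ℕ → ℕ → ℕ
fallingBy d c zero    = 1
fallingBy d c (suc s) = (c ∸ s * d) * fallingBy d c s

k>n⇒nP′k≡0 : ∀ {n k} → k > n → n P′ k ≡ 0
k>n⇒nP′k≡0 {n} {suc k} (s≤s n≤k) = cong (_* (n P′ k)) (m≤n⇒m∸n≡0 n≤k)

nCk*k!≡nP′k : ∀ n k → (n C k) * k ! ≡ n P′ k
nCk*k!≡nP′k n k with k ≤? n
... | no  k≰n = trans (cong (_* k !) (k>n⇒nCk≡0 (≰⇒> k≰n))) (sym (k>n⇒nP′k≡0 (≰⇒> k≰n)))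
... | yes k≤n = begin
  (n C k) * k !                ≡⟨ cong (_* k !) (nCk≡nPk/k! k≤n) ⟩
  ((n P k) / k !) * k !        ≡⟨ cong (λ p → p / k ! * k !) (trans (nPk≡n!/[n∸k]! k≤n) (sym (nP′k≡n!/[n∸k]! k≤n))) ⟩
  ((n P′ k) / k !) * k !       ≡⟨ m/n*n≡m (k!∣nP′k k≤n) ⟩
  n P′ k                       ∎
  where
    open ≡-Reasoning
    instance _ = k !≢0

P′*^≤fallingBy : ∀ {x d c} s → x * d ≤ c → (x P′ s) * d ^ s ≤ fallingBy d c s
P′*^≤fallingBy zero    _     = ≤-refl
P′*^≤fallingBy {x} {d} {c} (suc s) x*d≤c = begin
  ((x ∸ s) * (x P′ s)) * (d * d ^ s)    ≡⟨ interchange (x ∸ s) (x P′ s) d (d ^ s) ⟩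
  ((x ∸ s) * d) * ((x P′ s) * d ^ s)    ≤⟨ *-mono-≤ (≤-trans (≤-reflexive (*-distribʳ-∸ d x s)) (∸-monoˡ-≤ (s * d) x*d≤c))
                                                     (P′*^≤fallingBy s x*d≤c) ⟩
  (c ∸ s * d) * fallingBy d c s         ∎
  where
    open ≤-Reasoning
    open CommSemigroupProperties *-commutativeSemigroup

P′*^≤*fallingBy : ∀ {x d c} s → x * d ≤ c + d → suc s * d ≤ c →
                  (x P′ suc s) * d ^ suc s ≤ x * fallingBy d c (suc s)
P′*^≤*fallingBy {zero} {d} s _ _ = ≤-reflexive (cong (_* d ^ suc s) (k>n⇒nP′k≡0 {0} {suc s} (s≤s z≤n)))
P′*^≤*fallingBy {suc x} {d} {c} s 1+x*d≤c+d 1+s*d≤c = begin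
  (suc x P′ suc s) * (d * d ^ s)               ≡⟨ cong (_* (d * d ^ s)) (nP′k≡n[n∸1P′k∸1] (suc x) (suc s)) ⟩
  (suc x * (x P′ s)) * (d * d ^ s)             ≡⟨ solve 4 (λ a b u v → (a :* b) :* (u :* v) := a :* (u :* (b :* v))) refl (suc x) (x P′ s) d (d ^ s) ⟩
  suc x * (d * ((x P′ s) * d ^ s))             ≤⟨ *-monoʳ-≤ (suc x) (*-mono-≤ (m+n≤o⇒m≤o∸n d 1+s*d≤c) (P′*^≤fallingBy s x*d≤c)) ⟩
  suc x * ((c ∸ s * d) * fallingBy d c s)      ∎
  where
    open ≤-Reasoning
    open ℕSolver.+-*-Solver
    x*d≤c : x * d ≤ c
    x*d≤c = +-cancelˡ-≤ d _ _ (≤-trans 1+x*d≤c+d (≤-reflexive (+-comm c d)))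

P′-exchange : ∀ p q x y → suc q * suc x ≤ suc p * suc y →
              (x P′ suc p) * (suc y P′ suc q) ≤ (suc x P′ suc p) * (y P′ suc q)
P′-exchange p q x y h = begin
  ((x ∸ p) * X) * (suc y P′ suc q)        ≡⟨ cong (((x ∸ p) * X) *_) (nP′k≡n[n∸1P′k∸1] (suc y) (suc q)) ⟩
  ((x ∸ p) * X) * (suc y * Y)             ≡⟨ interchange (x ∸ p) X (suc y) Y ⟩
  ((x ∸ p) * suc y) * (X * Y)             ≤⟨ *-monoˡ-≤ (X * Y) ratio ⟩
  (suc x * (y ∸ q)) * (X * Y)             ≡⟨ interchange (suc x) (y ∸ q) X Y ⟩
  (suc x * X) * ((y ∸ q) * Y)             ≡⟨ cong (_* (y P′ suc q)) (nP′k≡n[n∸1P′k∸1] (suc x) (suc p)) ⟨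
  (suc x P′ suc p) * (y P′ suc q)         ∎
  where
    open ≤-Reasoning
    open CommSemigroupProperties *-commutativeSemigroup
    X Y : ℕ
    X = x P′ p
    Y = y P′ q
    ratio : (x ∸ p) * suc y ≤ suc x * (y ∸ q)
    ratio = begin
      (x ∸ p) * suc y                   ≡⟨ *-distribʳ-∸ (suc y) (suc x) (suc p) ⟩
      suc x * suc y ∸ suc p * suc y     ≤⟨ ∸-monoʳ-≤ (suc x * suc y) (≤-trans (≤-reflexive (*-comm (suc x) (suc q))) h) ⟩
      suc x * suc y ∸ suc x * suc q     ≡⟨ *-distribˡ-∸ (suc x) (suc y) (suc q) ⟨
      suc x * (y ∸ q)                   ∎

module _ {a ℓ} {A : Set a} {_∼_ : Rel A ℓ} (∼-refl : Reflexive _∼_) (∼-trans : Transitive _∼_) where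

  stepwise⇒monotone : ∀ (f : ℕ → A) {lo hi} → (∀ {x} → lo ≤ x → suc x ≤ hi → f x ∼ f (suc x)) →
                      ∀ {x y} → lo ≤ x → x ≤ y → y ≤ hi → f x ∼ f y
  stepwise⇒monotone f {lo} {hi} step {x} lo≤x x≤y = go (≤⇒≤′ x≤y)
    where
      go : ∀ {y} → x ≤′ y → y ≤ hi → f x ∼ f y
      go ≤′-refl         _     = ∼-refl
      go (≤′-step x≤′y) 1+y≤hi =
        ∼-trans (go x≤′y (<⇒≤ 1+y≤hi)) (step (≤-trans lo≤x (≤′⇒≤ x≤′y)) 1+y≤hi)

m∸n≡1+[m∸1+n] : ∀ {m n} → n < m → m ∸ n ≡ suc (m ∸ suc n)
m∸n≡1+[m∸1+n] = +-∸-assoc 1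

≤/⇒*≤ : ∀ {k n d} .{{_ : NonZero d}} → k ≤ n / d → k * d ≤ n
≤/⇒*≤ {k} {n} {d} k≤n/d = ≤-trans (*-monoˡ-≤ d k≤n/d) (m/n*n≤m n d)

*≤⇒≤/ : ∀ {k n d} .{{_ : NonZero d}} → k * d ≤ n → k ≤ n / d
*≤⇒≤/ {k} {n} {d} kd≤n = ≤-trans (≤-reflexive (sym (m*n/n≡m k d))) (/-monoˡ-≤ d kd≤n)

/≤⇒<* : ∀ {k n d} .{{_ : NonZero d}} → n / d ≤ k → n < suc k * d
/≤⇒<* n/d≤k = ≰⇒> (λ 1+k*d≤n → 1+n≰n (≤-trans (*≤⇒≤/ 1+k*d≤n) n/d≤k))

*-+-cancel-≤ : ∀ a b u v → u * (a + b) ≤ a * (u + v) → b * u ≤ a * v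
*-+-cancel-≤ a b u v h = +-cancelˡ-≤ (a * u) _ _ (begin
  a * u + b * u    ≡⟨ *-distribʳ-+ u a b ⟨
  (a + b) * u      ≡⟨ *-comm (a + b) u ⟩
  u * (a + b)      ≤⟨ h ⟩
  a * (u + v)      ≡⟨ *-distribˡ-+ a u v ⟩
  a * u + a * v    ∎)
  where open ≤-Reasoning

*-+-cancel-≥ : ∀ a b u v → a * (u + v) ≤ u * (a + b) → a * v ≤ b * u
*-+-cancel-≥ a b u v h = +-cancelˡ-≤ (a * u) _ _ (begin
  a * u + a * v    ≡⟨ *-distribˡ-+ a u v ⟨
  a * (u + v)      ≤⟨ h ⟩
  u * (a + b)      ≡⟨ *-comm u (a + b) ⟩
  (a + b) * u      ≡⟨ *-distribʳ-+ u a b ⟩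
  a * u + b * u    ∎)
  where open ≤-Reasoning

-- ℕ→ℚ n is stuck on a gcd computation; fromℤ (+ n) is its normal form.
ℕ→ℚ≡fromℤ : ∀ n → ℕ→ℚ n ≡ fromℤ (+ n)
ℕ→ℚ≡fromℤ n = ℚᴾ.normalize-coprime _

ℕ→ℚ-+ : ∀ a b → ℕ→ℚ (a + b) ≡ ℕ→ℚ a +ℚ ℕ→ℚ b
ℕ→ℚ-+ a b = begin
  ℕ→ℚ (a + b)                              ≡⟨ ℚᴾ./-cong (cong₂ ℤ._+_ (ℤᴾ.*-identityʳ (+ a)) (ℤᴾ.*-identityʳ (+ b))) refl ⟨
  fromℤ (+ a) +ℚ fromℤ (+ b)               ≡⟨ cong₂ _+ℚ_ (ℕ→ℚ≡fromℤ a) (ℕ→ℚ≡fromℤ b) ⟨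
  ℕ→ℚ a +ℚ ℕ→ℚ b                           ∎
  where open ≡-Reasoning

ℕ→ℚ-* : ∀ a b → ℕ→ℚ (a * b) ≡ ℕ→ℚ a *ℚ ℕ→ℚ b
ℕ→ℚ-* a b = begin
  ℕ→ℚ (a * b)                              ≡⟨ ℚᴾ./-cong (ℤᴾ.pos-* a b) refl ⟩
  fromℤ (+ a) *ℚ fromℤ (+ b)               ≡⟨ cong₂ _*ℚ_ (ℕ→ℚ≡fromℤ a) (ℕ→ℚ≡fromℤ b) ⟨
  ℕ→ℚ a *ℚ ℕ→ℚ b                           ∎
  where open ≡-Reasoning

ℕ→ℚ-mono-≤ : ∀ {a b} → a ≤ b → ℕ→ℚ a ≤ℚ ℕ→ℚ b
ℕ→ℚ-mono-≤ {a} {b} a≤b = subst₂ _≤ℚ_ (sym (ℕ→ℚ≡fromℤ a)) (sym (ℕ→ℚ≡fromℤ b))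
  (*≤* (ℤᴾ.*-monoʳ-≤-nonNeg (+ 1) (ℤ.+≤+ a≤b)))

ℕ→ℚ-∸ : ∀ {a b} → b ≤ a → ℕ→ℚ (a ∸ b) ≡ ℕ→ℚ a -ℚ ℕ→ℚ b
ℕ→ℚ-∸ {a} {b} b≤a = begin
  ℕ→ℚ (a ∸ b)                          ≡⟨ solve 2 (λ x y → x := (x :+ y) :- y) refl (ℕ→ℚ (a ∸ b)) (ℕ→ℚ b) ⟩
  (ℕ→ℚ (a ∸ b) +ℚ ℕ→ℚ b) -ℚ ℕ→ℚ b      ≡⟨ cong (_-ℚ ℕ→ℚ b) (ℕ→ℚ-+ (a ∸ b) b) ⟨
  ℕ→ℚ (a ∸ b + b) -ℚ ℕ→ℚ b             ≡⟨ cong (λ k → ℕ→ℚ k -ℚ ℕ→ℚ b) (m∸n+n≡m b≤a) ⟩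
  ℕ→ℚ a -ℚ ℕ→ℚ b                       ∎
  where
    open ≡-Reasoning
    open +-*-Solver

infix 4 _≐_/_

-- A record rather than the bare equation, so that g and d can be inferred.
record _≐_/_ (q : ℚ) (g d : ℕ) : Set where
  constructor mk≐
  field ≐-eq : q *ℚ ℕ→ℚ d ≡ ℕ→ℚ g

open _≐_/_

≐-* : ∀ {p q a b c d} → p ≐ a / b → q ≐ c / d → p *ℚ q ≐ a * c / (b * d)
≐-* {p} {q} {a} {b} {c} {d} (mk≐ p≐) (mk≐ q≐) = mk≐ (begin
  (p *ℚ q) *ℚ ℕ→ℚ (b * d)                ≡⟨ cong ((p *ℚ q) *ℚ_) (ℕ→ℚ-* b d) ⟩
  (p *ℚ q) *ℚ (ℕ→ℚ b *ℚ ℕ→ℚ d)          ≡⟨ interchange p q (ℕ→ℚ b) (ℕ→ℚ d) ⟩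
  (p *ℚ ℕ→ℚ b) *ℚ (q *ℚ ℕ→ℚ d)          ≡⟨ cong₂ _*ℚ_ p≐ q≐ ⟩
  ℕ→ℚ a *ℚ ℕ→ℚ c                         ≡⟨ ℕ→ℚ-* a c ⟨
  ℕ→ℚ (a * c)                            ∎)
  where
    open ≡-Reasoning
    open CommSemigroupProperties (CommutativeMonoid.commutativeSemigroup ℚᴾ.*-1-commutativeMonoid)

ℕ→ℚ-*-≐ : ∀ n {q g d} → q ≐ g / d → ℕ→ℚ n *ℚ q ≐ n * g / d
ℕ→ℚ-*-≐ n {q} {g} {d} (mk≐ q≐) = mk≐ (begin
  (ℕ→ℚ n *ℚ q) *ℚ ℕ→ℚ d                  ≡⟨ ℚᴾ.*-assoc (ℕ→ℚ n) q (ℕ→ℚ d) ⟩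
  ℕ→ℚ n *ℚ (q *ℚ ℕ→ℚ d)                  ≡⟨ cong (ℕ→ℚ n *ℚ_) q≐ ⟩
  ℕ→ℚ n *ℚ ℕ→ℚ g                         ≡⟨ ℕ→ℚ-* n g ⟨
  ℕ→ℚ (n * g)                            ∎)
  where open ≡-Reasoning

≐⇒≤ : ∀ {q g d} n .{{_ : NonZero d}} → q ≐ g / d → n * d ≤ g → ℕ→ℚ n ≤ℚ q
≐⇒≤ {q} {g} {d} n (mk≐ q≐) nd≤g = ℚᴾ.*-cancelʳ-≤-pos (ℕ→ℚ d) {{ℚᴾ.normalize-pos d 1}} (begin
  ℕ→ℚ n *ℚ ℕ→ℚ d    ≡⟨ ℕ→ℚ-* n d ⟨
  ℕ→ℚ (n * d)       ≤⟨ ℕ→ℚ-mono-≤ nd≤g ⟩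
  ℕ→ℚ g             ≡⟨ q≐ ⟨
  q *ℚ ℕ→ℚ d        ∎)
  where open ℚᴾ.≤-Reasoning

/-≐ : ∀ c d .{{_ : NonZero d}} → (+ c /ℚ d) ≐ c / d
/-≐ c (suc d) = mk≐ (ℚᴾ.toℚᵘ-injective (begin-equality
  toℚᵘ ((+ c /ℚ suc d) *ℚ ℕ→ℚ (suc d))
    ≃⟨ ℚᴾ.toℚᵘ-homo-* (+ c /ℚ suc d) (ℕ→ℚ (suc d)) ⟩
  toℚᵘ (+ c /ℚ suc d) ℚᵘ.* toℚᵘ (ℕ→ℚ (suc d))
    ≃⟨ ℚᵘᴾ.*-cong (ℚᴾ.toℚᵘ-fromℚᵘ (mkℚᵘ (+ c) d)) (ℚᴾ.toℚᵘ-fromℚᵘ (mkℚᵘ (+ suc d) 0)) ⟩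
  mkℚᵘ (+ c) d ℚᵘ.* mkℚᵘ (+ suc d) 0
    ≃⟨ *≡* (trans (ℤᴾ.*-identityʳ _) (cong (λ k → + c ℤ.* + k) (sym (*-identityʳ (suc d))))) ⟩
  mkℚᵘ (+ c) 0
    ≃⟨ ℚᴾ.toℚᵘ-fromℚᵘ (mkℚᵘ (+ c) 0) ⟨
  toℚᵘ (ℕ→ℚ c) ∎))
  where open ℚᵘᴾ.≤-Reasoning

fallingℚ-≐ : ∀ c d .{{_ : NonZero d}} s → s * d ≤ c → fallingℚ (+ c /ℚ d) s ≐ fallingBy d c s / d ^ s
fallingℚ-≐ c d zero    _    = mk≐ (ℚᴾ.*-identityˡ 1ℚ)
fallingℚ-≐ c d (suc s) 1+s*d≤c = mk≐ (begin
  F *ℚ (a -ℚ ℕ→ℚ s) *ℚ ℕ→ℚ (d * d ^ s)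
    ≡⟨ cong (F *ℚ (a -ℚ ℕ→ℚ s) *ℚ_) (ℕ→ℚ-* d (d ^ s)) ⟩
  F *ℚ (a -ℚ ℕ→ℚ s) *ℚ (ℕ→ℚ d *ℚ ℕ→ℚ (d ^ s))
    ≡⟨ solve 5 (λ f x y z w → f :* (x :- y) :* (z :* w) := (x :* z :- y :* z) :* (f :* w)) refl F a (ℕ→ℚ s) (ℕ→ℚ d) (ℕ→ℚ (d ^ s)) ⟩
  (a *ℚ ℕ→ℚ d -ℚ ℕ→ℚ s *ℚ ℕ→ℚ d) *ℚ (F *ℚ ℕ→ℚ (d ^ s))
    ≡⟨ cong₂ (λ u v → (u -ℚ v) *ℚ (F *ℚ ℕ→ℚ (d ^ s))) (≐-eq (/-≐ c d)) (sym (ℕ→ℚ-* s d)) ⟩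
  (ℕ→ℚ c -ℚ ℕ→ℚ (s * d)) *ℚ (F *ℚ ℕ→ℚ (d ^ s))
    ≡⟨ cong₂ _*ℚ_ (sym (ℕ→ℚ-∸ s*d≤c)) (≐-eq (fallingℚ-≐ c d s s*d≤c)) ⟩
  ℕ→ℚ (c ∸ s * d) *ℚ ℕ→ℚ (fallingBy d c s)
    ≡⟨ ℕ→ℚ-* (c ∸ s * d) (fallingBy d c s) ⟨
  ℕ→ℚ (fallingBy d c (suc s)) ∎)
  where
    open ≡-Reasoning
    open +-*-Solver
    a F : ℚ
    a = + c /ℚ d
    F = fallingℚ a s
    s*d≤c : s * d ≤ c
    s*d≤c = ≤-trans (m≤n+m (s * d) d) 1+s*d≤c

binomℚ-≥ : ∀ x s → ℕ→ℚ s ≤ℚ x → binomℚ x s ≡ fallingℚ x s *ℚ (+ 1 /ℚ s !) {{s !≢0}}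
binomℚ-≥ x s s≤x with ℕ→ℚ s ℚᴾ.≤? x
... | yes _   = refl
... | no  s≰x = contradiction s≤x s≰x

binomℚ-≐ : ∀ c d .{{_ : NonZero d}} s → s * d ≤ c → binomℚ (+ c /ℚ d) s ≐ fallingBy d c s / (d ^ s * s !)
binomℚ-≐ c d s s*d≤c = mk≐ (begin
  binomℚ a s *ℚ ℕ→ℚ (d ^ s * s !)
    ≡⟨ cong (_*ℚ ℕ→ℚ (d ^ s * s !)) (binomℚ-≥ a s (≐⇒≤ s (/-≐ c d) s*d≤c)) ⟩
  fallingℚ a s *ℚ (+ 1 /ℚ s !) {{s !≢0}} *ℚ ℕ→ℚ (d ^ s * s !)
    ≡⟨ ≐-eq (≐-* (fallingℚ-≐ c d s s*d≤c) (/-≐ 1 (s !) {{s !≢0}})) ⟩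
  ℕ→ℚ (fallingBy d c s * 1)
    ≡⟨ cong ℕ→ℚ (*-identityʳ (fallingBy d c s)) ⟩
  ℕ→ℚ (fallingBy d c s) ∎)
  where
    open ≡-Reasoning
    a : ℚ
    a = + c /ℚ d

module BinomialProduct (p₁ p₂ m : ℕ) where

  s₁ s₂ S : ℕ
  s₁ = suc p₁
  s₂ = suc p₂
  S  = s₁ + s₂

  Φ : ℕ → ℕ
  Φ x = (x P′ s₁) * ((m ∸ x) P′ s₂)

  x₀ : ℕ
  x₀ = (s₁ * m + s₁) / S

  Φ-step-≤ : ∀ {x} → x < m → s₂ * suc x ≤ s₁ * (m ∸ x) → Φ x ≤ Φ (suc x)
  Φ-step-≤ {x} x<m h rewrite m∸n≡1+[m∸1+n] x<m = P′-exchange p₁ p₂ x (m ∸ suc x) h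

  Φ-step-≥ : ∀ {x} → x < m → s₁ * (m ∸ x) ≤ s₂ * suc x → Φ (suc x) ≤ Φ x
  Φ-step-≥ {x} x<m h rewrite m∸n≡1+[m∸1+n] x<m =
    subst₂ _≤_ (*-comm (t P′ s₂) (suc x P′ s₁)) (*-comm (suc t P′ s₂) (x P′ s₁)) (P′-exchange p₂ p₁ t x h)
    where
      t : ℕ
      t = m ∸ suc x

  s₁*m+s₁≡s₁*[1+x+[m∸x]] : ∀ {x} → x ≤ m → s₁ * m + s₁ ≡ s₁ * (suc x + (m ∸ x))
  s₁*m+s₁≡s₁*[1+x+[m∸x]] {x} x≤m = begin
    s₁ * m + s₁               ≡⟨ +-comm (s₁ * m) s₁ ⟩
    s₁ + s₁ * m               ≡⟨ *-suc s₁ m ⟨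
    s₁ * suc m                ≡⟨ cong (λ k → s₁ * suc k) (m+[n∸m]≡n x≤m) ⟨
    s₁ * (suc x + (m ∸ x))    ∎
    where open ≡-Reasoning

  x₀≤m : x₀ ≤ m
  x₀≤m = m<1+n⇒m≤n (m<n*o⇒m/o<n (begin-strict
    s₁ * m + s₁                 ≡⟨ +-comm (s₁ * m) s₁ ⟩
    s₁ + s₁ * m                 ≡⟨ cong (_+_ s₁) (*-comm s₁ m) ⟩
    suc m * s₁                  <⟨ m<m+n (suc m * s₁) (s≤s z≤n) ⟩
    suc m * s₁ + suc m * s₂     ≡⟨ *-distribˡ-+ (suc m) s₁ s₂ ⟨
    suc m * S                   ∎))
    where open ≤-Reasoning

  Φ-monotone : ∀ {x y} → x ≤ y → y ≤ x₀ → Φ x ≤ Φ y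
  Φ-monotone = stepwise⇒monotone {_∼_ = _≤_} ≤-refl ≤-trans Φ step z≤n
    where
      step : ∀ {x} → 0 ≤ x → suc x ≤ x₀ → Φ x ≤ Φ (suc x)
      step {x} _ 1+x≤x₀ = Φ-step-≤ x<m (*-+-cancel-≤ s₁ s₂ (suc x) (m ∸ x)
        (≤-trans (≤/⇒*≤ 1+x≤x₀) (≤-reflexive (s₁*m+s₁≡s₁*[1+x+[m∸x]] (<⇒≤ x<m)))))
        where
          x<m : x < m
          x<m = ≤-trans 1+x≤x₀ x₀≤m

  Φ-antitone : ∀ {x y} → x₀ ≤ x → x ≤ y → y ≤ m → Φ y ≤ Φ x
  Φ-antitone = stepwise⇒monotone {_∼_ = _≥_} ≤-refl (flip ≤-trans) Φ step
    where
      step : ∀ {x} → x₀ ≤ x → suc x ≤ m → Φ (suc x) ≤ Φ x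
      step {x} x₀≤x x<m = Φ-step-≥ x<m (*-+-cancel-≥ s₁ s₂ (suc x) (m ∸ x)
        (≤-trans (≤-reflexive (sym (s₁*m+s₁≡s₁*[1+x+[m∸x]] (<⇒≤ x<m)))) (<⇒≤ (/≤⇒<* x₀≤x))))

  Φ-max : ∀ {x} → x ≤ m → Φ x ≤ Φ x₀
  Φ-max {x} x≤m with ≤-total x x₀
  ... | inj₁ x≤x₀ = Φ-monotone x≤x₀ ≤-refl
  ... | inj₂ x₀≤x = Φ-antitone ≤-refl x₀≤x x≤m

  G₁ G₂ : ℕ
  G₁ = fallingBy S (s₁ * m) s₁
  G₂ = fallingBy S (s₂ * m) s₂

  Φ-peak-bound : S ≤ m → Φ x₀ * (S ^ s₁ * S ^ s₂) ≤ m * m * (G₁ * G₂)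
  Φ-peak-bound S≤m = begin
    Φ x₀ * (S ^ s₁ * S ^ s₂)
      ≡⟨ interchange (x₀ P′ s₁) ((m ∸ x₀) P′ s₂) (S ^ s₁) (S ^ s₂) ⟩
    ((x₀ P′ s₁) * S ^ s₁) * (((m ∸ x₀) P′ s₂) * S ^ s₂)
      ≤⟨ *-mono-≤ (P′*^≤*fallingBy p₁ x₀*S≤s₁*m+S (*-monoʳ-≤ s₁ S≤m)) (P′*^≤*fallingBy p₂ [m∸x₀]*S≤s₂*m+S (*-monoʳ-≤ s₂ S≤m)) ⟩
    (x₀ * G₁) * ((m ∸ x₀) * G₂)
      ≤⟨ *-mono-≤ (*-monoˡ-≤ G₁ x₀≤m) (*-monoˡ-≤ G₂ (m∸n≤m m x₀)) ⟩
    (m * G₁) * (m * G₂)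
      ≡⟨ interchange m G₁ m G₂ ⟩
    m * m * (G₁ * G₂) ∎
    where
      open ≤-Reasoning
      open CommSemigroupProperties *-commutativeSemigroup
      x₀*S≤s₁*m+S : x₀ * S ≤ s₁ * m + S
      x₀*S≤s₁*m+S = ≤-trans (m/n*n≤m (s₁ * m + s₁) S) (+-monoʳ-≤ (s₁ * m) (m≤m+n s₁ s₂))
      m*S≤x₀*S+[s₂*m+S] : m * S ≤ x₀ * S + (s₂ * m + S)
      m*S≤x₀*S+[s₂*m+S] = begin
        m * S                   ≡⟨ *-comm m S ⟩
        S * m                   ≡⟨ *-distribʳ-+ m s₁ s₂ ⟩
        s₁ * m + s₂ * m         ≤⟨ +-monoˡ-≤ (s₂ * m) (≤-trans (m≤m+n (s₁ * m) s₁) (<⇒≤ (/≤⇒<* (≤-refl {x₀})))) ⟩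
        suc x₀ * S + s₂ * m     ≡⟨ solve 3 (λ a b c → (b :+ a) :+ c := a :+ (c :+ b)) refl (x₀ * S) S (s₂ * m) ⟩
        x₀ * S + (s₂ * m + S)   ∎
        where open ℕSolver.+-*-Solver
      [m∸x₀]*S≤s₂*m+S : (m ∸ x₀) * S ≤ s₂ * m + S
      [m∸x₀]*S≤s₂*m+S = begin
        (m ∸ x₀) * S            ≡⟨ *-distribʳ-∸ S m x₀ ⟩
        m * S ∸ x₀ * S          ≤⟨ m≤n+o⇒m∸n≤o (m * S) (x₀ * S) m*S≤x₀*S+[s₂*m+S] ⟩
        s₂ * m + S              ∎

  f : ℕ → ℕ
  f x = (x C s₁) * ((m ∸ x) C s₂)

  f*s₁!*s₂!≡Φ : ∀ x → f x * (s₁ ! * s₂ !) ≡ Φ x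
  f*s₁!*s₂!≡Φ x = trans (interchange (x C s₁) ((m ∸ x) C s₂) (s₁ !) (s₂ !)) (cong₂ _*_ (nCk*k!≡nP′k x s₁) (nCk*k!≡nP′k (m ∸ x) s₂))
    where open CommSemigroupProperties *-commutativeSemigroup

  Φ≤⇒f≤ : ∀ {x y} → Φ x ≤ Φ y → f x ≤ f y
  Φ≤⇒f≤ {x} {y} Φx≤Φy = *-cancelʳ-≤ (f x) (f y) (s₁ ! * s₂ !) {{s₁ !* s₂ !≢0}}
    (subst₂ _≤_ (sym (f*s₁!*s₂!≡Φ x)) (sym (f*s₁!*s₂!≡Φ y)) Φx≤Φy)

  f-bound : S ≤ m → ∀ {x} → x ≤ m → f x * ((S ^ s₁ * s₁ !) * (S ^ s₂ * s₂ !)) ≤ 4 * (m * m) * G₁ * G₂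
  f-bound S≤m {x} x≤m = begin
    f x * ((S ^ s₁ * s₁ !) * (S ^ s₂ * s₂ !))
      ≡⟨ solve 5 (λ a b c d e → a :* ((b :* c) :* (d :* e)) := (a :* (c :* e)) :* (b :* d)) refl (f x) (S ^ s₁) (s₁ !) (S ^ s₂) (s₂ !) ⟩
    (f x * (s₁ ! * s₂ !)) * (S ^ s₁ * S ^ s₂)   ≡⟨ cong (_* (S ^ s₁ * S ^ s₂)) (f*s₁!*s₂!≡Φ x) ⟩
    Φ x * (S ^ s₁ * S ^ s₂)                      ≤⟨ *-monoˡ-≤ (S ^ s₁ * S ^ s₂) (Φ-max x≤m) ⟩
    Φ x₀ * (S ^ s₁ * S ^ s₂)                     ≤⟨ Φ-peak-bound S≤m ⟩
    m * m * (G₁ * G₂)                            ≤⟨ *-monoˡ-≤ (G₁ * G₂) (m≤n*m (m * m) 4) ⟩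
    4 * (m * m) * (G₁ * G₂)                      ≡⟨ *-assoc (4 * (m * m)) G₁ G₂ ⟨
    4 * (m * m) * G₁ * G₂                        ∎
    where
      open ≤-Reasoning
      open ℕSolver.+-*-Solver

lemmaB1 : (s₁ s₂ m : ℕ) → 1 ≤ s₁ → s₁ ≤ s₂ → s₂ ≤ m → s₁ + s₂ ≤ m →
            .{{_ : NonZero (s₁ + s₂)}} →
            ((x : ℕ) → x ≤ m →
              ℕ→ℚ ((x C s₁) * ((m ∸ x) C s₂))
                ≤ℚ ℕ→ℚ (4 * (m * m))
                   *ℚ binomℚ ((+ (s₁ * m)) /ℚ (s₁ + s₂)) s₁
                   *ℚ binomℚ ((+ (s₂ * m)) /ℚ (s₁ + s₂)) s₂)
            × ((x y : ℕ) → x ≤ y → y ≤ (s₁ * m + s₁) / (s₁ + s₂) →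
                (x C s₁) * ((m ∸ x) C s₂) ≤ (y C s₁) * ((m ∸ y) C s₂))
            × ((x y : ℕ) → (s₁ * m + s₁) / (s₁ + s₂) ≤ x → x ≤ y → y ≤ m →
                (y C s₁) * ((m ∸ y) C s₂) ≤ (x C s₁) * ((m ∸ x) C s₂))
lemmaB1 (suc p₁) (suc p₂) m (s≤s z≤n) (s≤s _) _ S≤m =
    (λ x x≤m → ≐⇒≤ (f x) {{denominator≢0}}
       (≐-* (ℕ→ℚ-*-≐ (4 * (m * m)) (binomℚ-≐ (s₁ * m) S s₁ (*-monoʳ-≤ s₁ S≤m)))
            (binomℚ-≐ (s₂ * m) S s₂ (*-monoʳ-≤ s₂ S≤m)))
       (f-bound S≤m x≤m))
  , (λ _ _ x≤y y≤x₀ → Φ≤⇒f≤ (Φ-monotone x≤y y≤x₀))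
  , (λ _ _ x₀≤x x≤y y≤m → Φ≤⇒f≤ (Φ-antitone x₀≤x x≤y y≤m))
  where
    open BinomialProduct p₁ p₂ m
    denominator≢0 : NonZero ((S ^ s₁ * s₁ !) * (S ^ s₂ * s₂ !))
    denominator≢0 = m*n≢0 _ _ {{m*n≢0 _ _ {{m^n≢0 S s₁}} {{s₁ !≢0}}}} {{m*n≢0 _ _ {{m^n≢0 S s₂}} {{s₂ !≢0}}}}
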